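{- Let $\pi$ be a permutation of $[n]$ such that the graph $G_\pi$ is bipartite. Let $(A,B)$ be a partition of $[n]$ such that every vertex in $A$ is a type-$A$ vertex and every vertex in $B$ is a type-$B$ vertex. Then the natural order $1<2<\dots<n$, restricted to $A$ and to $B$ respectively, is a strong ordering of $A\cup B$: for all edges $\{a,b\},\{a',b'\}$ of $G_\pi$ with $a,a'\in A$, $b,b'\in B$, $a<a'$ and $b>b'$, both $\{a,b'\}$ and $\{a',b\}$ are edges of $G_\pi$.
   Context: For a permutation $\pi$ of $[n]$, $G_\pi$ is the graph on $[n]$ in which $\{i,j\}$ with $i>j$ is an edge iff $\pi^{ -1}(i)<\pi^{ -1}(j)$. A vertex $v$ is of type $A$ if $\pi^{ -1}$ has a left-to-right maximum at $v$, i.e. $\pi^{ -1}(v)\ge\pi^{ -1}(u)$ for all $u<v$; it is of type $B$ if $\pi^{ -1}$ has a right-to-left minimum at $v$, i.e. $\pi^{ -1}(v)\le\pi^{ -1}(u)$ for all $u>v$. -}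

module Defs where

open import Data.Nat using (ℕ)
open import Data.Fin using (Fin; _<_; _≤_)
open import Data.Fin.Permutation using (Permutation′; _⟨$⟩ʳ_; _⟨$⟩ˡ_)
open import Data.Bool using (Bool; true; false)
open import Data.Product using (∃)
open import Relation.Binary.PropositionalEquality using (_≡_; _≢_)

-- A permutation π of [n]; vertices are Fin n (0-indexed, order-preserving
-- relabelling of 1..n).  π ⟨$⟩ʳ i = π(i), π ⟨$⟩ˡ v = π⁻¹(v).
Perm : ℕ → Set
Perm n = Permutation′ n

πinv : ∀ {n} → Perm n → Fin n → Fin n
πinv π v = π ⟨$⟩ˡ v

EdgeOrd : ∀ {n} → Perm n → Fin n → Fin n → Set
EdgeOrd π i j = j < i × πinv π i < πinv π j
  where open import Data.Product using (_×_)

Edge : ∀ {n} → Perm n → Fin n → Fin n → Set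
Edge π u v = EdgeOrd π u v ⊎ EdgeOrd π v u
  where open import Data.Sum using (_⊎_)

Bipartite : ∀ {n} → Perm n → Set
Bipartite {n} π = ∃ λ (c : Fin n → Bool) → ∀ u v → Edge π u v → c u ≢ c v

TypeA : ∀ {n} → Perm n → Fin n → Set
TypeA π v = ∀ u → u < v → πinv π u ≤ πinv π v

TypeB : ∀ {n} → Perm n → Fin n → Set
TypeB π v = ∀ u → v < u → πinv π v ≤ πinv π u

module Submission where

open import Defs
open import Data.Nat using (ℕ)
open import Data.Fin using (Fin; _<_)
open import Data.Bool using (Bool; true; false)
open import Data.Product using (_×_; _,_)
open import Data.Sum using (inj₁; inj₂)
open import Data.Empty using (⊥-elim)
open import Relation.Binary.PropositionalEquality using (_≡_)
import Data.Nat.Properties as ℕ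

-- A type-A vertex has no smaller neighbour, so each given edge goes up from its
-- A-end and π⁻¹(b) < π⁻¹(a).  Then π⁻¹(b') ≤ π⁻¹(b) < π⁻¹(a) ≤ π⁻¹(a') by the
-- type-B property of b' and the type-A property of a', which yields both
-- edges.

edge-of-TypeA : ∀ {n} (π : Perm n) {u v : Fin n} →
                TypeA π u → Edge π u v → EdgeOrd π v u
edge-of-TypeA π tA (inj₁ (v<u , πu<πv)) = ⊥-elim (ℕ.<⇒≱ πu<πv (tA _ v<u))
edge-of-TypeA π tA (inj₂ e)             = e

mainTheorem4 : (n : ℕ) (π : Perm n) → Bipartite π →
    (inA : Fin n → Bool) →
    (∀ v → inA v ≡ true → TypeA π v) →
    (∀ v → inA v ≡ false → TypeB π v) →
    ∀ a a' b b' → inA a ≡ true → inA a' ≡ true → inA b ≡ false → inA b' ≡ false →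
    Edge π a b → Edge π a' b' → a < a' → b' < b →
    Edge π a b' × Edge π a' b
mainTheorem4 n π _ inA tA tB a a' b b' ha ha' hb hb' ab a'b' a<a' b'<b
  with edge-of-TypeA π (tA a ha) ab | edge-of-TypeA π (tA a' ha') a'b'
... | a<b , πb<πa | a'<b' , _ =
  inj₂ (ℕ.<-trans a<a' a'<b' , ℕ.≤-<-trans (tB b' hb' b b'<b) πb<πa) ,
  inj₂ (ℕ.<-trans a'<b' b'<b , ℕ.<-≤-trans πb<πa (tA a' ha' a a<a'))
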